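{- For every positive integer $r$, the Ramsey number of the $r$-dimensional cube satisfies $r(Q_r)\le 2^{3r}$.
   Context: The $r$-cube $Q_r$ is the graph with vertex set $\{0,1\}^r$ in which two vectors are adjacent if and only if they differ in exactly one coordinate. For a graph $H$, the Ramsey number $r(H)$ is the minimum positive integer $N$ such that every $2$-coloring of the edges of the complete graph $K_N$ contains a monochromatic copy of $H$. -}

module Defs where

open import Data.Nat using (ℕ; zero; suc; _+_)
open import Data.Bool using (Bool; true; false; _≟_)
open import Data.Fin using (Fin)
open import Data.Vec using (Vec; []; _∷_)
open import Data.Product using (Σ; _×_; ∃)
open import Relation.Binary.PropositionalEquality using (_≡_; _≢_)
open import Relation.Nullary using (yes; no)
open import Function.Definitions using (Injective)

hamming : ∀ {r} → Vec Bool r → Vec Bool r → ℕ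
hamming [] [] = 0
hamming (x ∷ xs) (y ∷ ys) with x ≟ y
... | yes _ = hamming xs ys
... | no  _ = suc (hamming xs ys)

CubeAdj : ∀ {r} → Vec Bool r → Vec Bool r → Set
CubeAdj u v = hamming u v ≡ 1

-- A 2-colouring of the edges of K_N (vertex set Fin N): a colour for each
-- pair of distinct vertices, symmetric in the two endpoints (colour of the
-- diagonal i,i is irrelevant).
record TwoColouring (N : ℕ) : Set where
  field
    colour    : Fin N → Fin N → Fin 2
    symmetric : ∀ i j → colour i j ≡ colour j i

open TwoColouring public

MonoCube : ∀ {N} → TwoColouring N → (r : ℕ) → Set
MonoCube {N} c r =
  Σ (Fin 2) λ k → Σ (Vec Bool r → Fin N) λ f →
    Injective _≡_ _≡_ f ×
    (∀ u v → CubeAdj u v → colour c (f u) (f v) ≡ k)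

-- r(Q_r) ≤ M  ⇔  every 2-colouring of K_M contains a monochromatic Q_r.
-- (Equivalent to the minimum-based definition since the property is
-- monotone in M; here it is the defining property at M.)
CubeRamseyAtMost : ℕ → ℕ → Set
CubeRamseyAtMost r M = (c : TwoColouring M) → MonoCube c r

-- The proof is dependent random choice, derandomised by averaging.  Put H = N/2,
-- m = 2^r, k = 2^(r-1) and t = 2r - 1.
--  * Majority colour.  Each vertex has 2H - 1 neighbours, so its degree is at least H
--    in some colour; hence for some colour κ the set W of vertices of κ-degree ≥ H
--    has at least H elements.
--  * Dependent random choice.  Call an r-tuple bad if it has fewer than m common
--    κ-neighbours.  Restricting W t times to the neighbourhood of a vertex chosen by
--    averaging preserves the potential  bad(U)·mⁱ + k·Nⁱ ≤ |U|·Hⁱ  (i = rounds left);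
--    deleting one vertex of every remaining bad tuple then leaves k vertices all of
--    whose r-tuples have at least m common neighbours.
--  * Embedding.  The 2^(r-1) even vertices of Q_r go injectively into that set; each
--    odd vertex goes to a fresh common neighbour of the images of its r neighbours.

module Submission where

open import Defs
open import Data.Nat using (ℕ; zero; suc; _+_; _*_; _^_; _≤_; _<_; _<?_; _≤?_; z≤n; s≤s)
open import Data.Nat.Properties hiding (_≟_)
open import Data.Nat.Properties using () renaming (_≟_ to _≟ℕ_)
open import Data.Nat.Tactic.RingSolver using (solve-∀)
open import Data.Fin using (Fin; zero; suc; fromℕ<)
open import Data.Fin.Properties using (_≟_)
open import Data.Vec using (Vec; []; _∷_; tail; tabulate; lookup)
open import Data.Vec.Properties using (lookup∘tabulate; ≡-dec)
open import Data.List using (List; []; _∷_; length; map; _++_)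
open import Data.List.Properties using (length-map; length-++)
open import Data.List.Membership.Propositional using (_∈_; _∉_)
open import Data.List.Membership.Propositional.Properties using (∈-map⁺; ∈-++⁺ˡ; ∈-++⁺ʳ)
import Data.List.Membership.DecPropositional as DecMembership
open import Data.List.Relation.Unary.Any using (here; there)
open import Data.Bool using (Bool; true; false; T; not; _∧_; _∨_; _xor_; if_then_else_)
import Data.Bool as Bool
open import Data.Bool.Properties
  using (T-∧; ∧-assoc; ∧-identityʳ; ∧-commutativeMonoid; not-¬; ¬-not; not-involutive;
         not-distribˡ-xor; not-distribʳ-xor; xor-inverseˡ)
open import Data.Product using (Σ; _×_; _,_; proj₁; proj₂; ∃)
open import Data.Sum using (_⊎_; inj₁; inj₂)
open import Data.Empty using (⊥; ⊥-elim)
open import Function using (_∘_)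
open import Function.Bundles using (Equivalence)
open import Function.Definitions using (Injective)
open import Relation.Nullary using (Dec; yes; no; does)
open import Relation.Nullary.Decidable using (dec-true)
open import Relation.Binary.Definitions using (DecidableEquality)
open import Relation.Binary.PropositionalEquality
open import Algebra.Bundles using (CommutativeMonoid)
open import Algebra.Properties.CommutativeSemigroup
  (CommutativeMonoid.commutativeSemigroup ∧-commutativeMonoid)
  using () renaming (interchange to ∧-interchange)
open import Algebra.Properties.Semiring.Sum +-*-semiring
  using (sum; sum-syntax; ∑-comm; ∑-distrib-+; sum-cong-≗; *-distribˡ-sum; *-distribʳ-sum)

-- Sets of vertices are boolean predicates; ind turns membership into a 0/1 count.
ind : Bool → ℕ
ind true  = 1
ind false = 0

ind≤1 : ∀ b → ind b ≤ 1
ind≤1 true  = ≤-refl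
ind≤1 false = z≤n

T⇒1≤ind : ∀ {b} → T b → 1 ≤ ind b
T⇒1≤ind {true} _ = ≤-refl

ind-∧ : ∀ a b → ind (a ∧ b) ≡ ind a * ind b
ind-∧ true  b = sym (*-identityˡ (ind b))
ind-∧ false b = refl

ind-∨ : ∀ a b → ind (a ∨ b) ≤ ind a + ind b
ind-∨ true  b = s≤s z≤n
ind-∨ false b = ≤-refl

ind-mono : ∀ {a b} → (T a → T b) → ind a ≤ ind b
ind-mono {false}         _   = z≤n
ind-mono {true} {true}   _   = ≤-refl
ind-mono {true} {false} a⇒b = ⊥-elim (a⇒b _)

ind-< : ∀ {a b} → ind a < ind b → (T a → ⊥) × T b
ind-< {false} {true} _ = (λ ()) , _
ind-< {true}  {true} (s≤s ())

does-sound : ∀ {A : Set} (d : Dec A) → T (does d) → A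
does-sound (yes a) _ = a

does-complete : ∀ {A : Set} (d : Dec A) → A → T (does d)
does-complete (yes _) _ = _
does-complete (no ¬a) a = ¬a a

∑-mono : ∀ {n} {f g : Fin n → ℕ} → (∀ i → f i ≤ g i) → sum f ≤ sum g
∑-mono {zero}  f≤g = z≤n
∑-mono {suc n} f≤g = +-mono-≤ (f≤g zero) (∑-mono (λ i → f≤g (suc i)))

∑-const : ∀ n c → ∑[ i < n ] c ≡ n * c
∑-const zero    c = refl
∑-const (suc n) c = cong (c +_) (∑-const n c)

∑-ones : ∀ n → ∑[ i < n ] 1 ≡ n
∑-ones n = trans (∑-const n 1) (*-identityʳ n)

term≤∑ : ∀ {n} (f : Fin n → ℕ) i → f i ≤ sum f
term≤∑ f zero    = m≤m+n (f zero) _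
term≤∑ f (suc i) = ≤-trans (term≤∑ (λ j → f (suc j)) i) (m≤n+m _ (f zero))

∑-witness : ∀ {n} (f g : Fin n → ℕ) → sum f < sum g → ∃ λ i → f i < g i
∑-witness {suc n} f g lt with f zero <? g zero
... | yes first  = zero , first
... | no  ¬first =
  let i , fi<gi = ∑-witness (λ i → f (suc i)) (λ i → g (suc i))
                    (+-cancelˡ-< (g zero) _ _ (≤-<-trans (+-monoˡ-≤ _ (≮⇒≥ ¬first)) lt))
  in suc i , fi<gi

averaging : ∀ {n} (f g : Fin n → ℕ) → 0 < n → sum g ≤ sum f → ∃ λ i → g i ≤ f i
averaging {suc n} f g _ le =
  let i , lt = ∑-witness g (λ i → suc (f i)) (≤-<-trans le sum<sum-suc)
  in i , ≤-pred lt
  where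
  sum<sum-suc : sum f < sum (λ i → suc (f i))
  sum<sum-suc = +-mono-<-≤ ≤-refl (∑-mono (λ i → n≤1+n (f (suc i))))

count : ∀ {n} → (Fin n → Bool) → ℕ
count P = sum (λ i → ind (P i))

count≤ : ∀ {n} (P : Fin n → Bool) → count P ≤ n
count≤ {n} P = ≤-trans (∑-mono (λ i → ind≤1 (P i))) (≤-reflexive (∑-ones n))

count-single : ∀ {n} (u : Fin n) → count (λ v → does (v ≟ u)) ≤ 1
count-single {suc n} zero    = ≤-reflexive (cong suc (trans (∑-const n 0) (*-zeroʳ n)))
count-single {suc n} (suc u) = count-single u

∑ᵗ : ∀ {n} r → (Vec (Fin n) r → ℕ) → ℕ
∑ᵗ zero    f = f []
∑ᵗ (suc r) f = sum (λ x → ∑ᵗ r (λ s → f (x ∷ s)))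

∑ᵗ-cong : ∀ {n} r {f g : Vec (Fin n) r → ℕ} → (∀ s → f s ≡ g s) → ∑ᵗ r f ≡ ∑ᵗ r g
∑ᵗ-cong zero    f≡g = f≡g []
∑ᵗ-cong (suc r) f≡g = sum-cong-≗ (λ x → ∑ᵗ-cong r (λ s → f≡g (x ∷ s)))

∑ᵗ-mono : ∀ {n} r {f g : Vec (Fin n) r → ℕ} → (∀ s → f s ≤ g s) → ∑ᵗ r f ≤ ∑ᵗ r g
∑ᵗ-mono zero    f≤g = f≤g []
∑ᵗ-mono (suc r) f≤g = ∑-mono (λ x → ∑ᵗ-mono r (λ s → f≤g (x ∷ s)))

∑ᵗ-*ʳ : ∀ {n} r (f : Vec (Fin n) r → ℕ) c → ∑ᵗ r (λ s → f s * c) ≡ ∑ᵗ r f * c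
∑ᵗ-*ʳ zero    f c = refl
∑ᵗ-*ʳ (suc r) f c =
  trans (sum-cong-≗ (λ x → ∑ᵗ-*ʳ r (λ s → f (x ∷ s)) c))
        (sym (*-distribʳ-sum c (λ x → ∑ᵗ r (λ s → f (x ∷ s)))))

∑-∑ᵗ-comm : ∀ {m n} r (f : Fin m → Vec (Fin n) r → ℕ) →
            sum (λ v → ∑ᵗ r (f v)) ≡ ∑ᵗ r (λ s → sum (λ v → f v s))
∑-∑ᵗ-comm zero    f = refl
∑-∑ᵗ-comm (suc r) f =
  trans (∑-comm (λ v x → ∑ᵗ r (λ s → f v (x ∷ s))))
        (sum-cong-≗ (λ x → ∑-∑ᵗ-comm r (λ v s → f v (x ∷ s))))

term≤∑ᵗ : ∀ {n} r (f : Vec (Fin n) r → ℕ) s → f s ≤ ∑ᵗ r f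
term≤∑ᵗ zero    f []      = ≤-refl
term≤∑ᵗ (suc r) f (x ∷ s) =
  ≤-trans (term≤∑ᵗ r (λ s → f (x ∷ s)) s) (term≤∑ (λ y → ∑ᵗ r (λ s → f (y ∷ s))) x)

within : ∀ {n r} → (Fin n → Bool) → Vec (Fin n) r → Bool
within U []      = true
within U (x ∷ s) = U x ∧ within U s

within-mono : ∀ {n r} {V U : Fin n → Bool} → (∀ u → T (V u) → T (U u)) →
              (s : Vec (Fin n) r) → T (within V s) → T (within U s)
within-mono V⊆U []      _  = _
within-mono V⊆U (x ∷ s) xs∈V =
  let x∈V , s∈V = Equivalence.to T-∧ xs∈V
  in Equivalence.from T-∧ (V⊆U x x∈V , within-mono V⊆U s s∈V)

count-within : ∀ {n} r (U : Fin n → Bool) → ∑ᵗ r (λ s → ind (within U s)) ≡ count U ^ r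
count-within zero    U = refl
count-within (suc r) U = begin
  sum (λ x → ∑ᵗ r (λ s → ind (U x ∧ within U s)))
    ≡⟨ sum-cong-≗ (λ x → ∑ᵗ-cong r (λ s → trans (ind-∧ (U x) _) (*-comm (ind (U x)) _))) ⟩
  sum (λ x → ∑ᵗ r (λ s → ind (within U s) * ind (U x)))
    ≡⟨ sum-cong-≗ (λ x → trans (∑ᵗ-*ʳ r _ (ind (U x))) (cong (_* ind (U x)) (count-within r U))) ⟩
  sum (λ x → count U ^ r * ind (U x))
    ≡⟨ sym (*-distribˡ-sum (count U ^ r) (λ x → ind (U x))) ⟩
  count U ^ r * count U
    ≡⟨ *-comm (count U ^ r) (count U) ⟩
  count U ^ suc r ∎
  where open ≡-Reasoning

module _ {n : ℕ} where
  open DecMembership (_≟_ {n}) using (_∈?_)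

  count-∈ : (F : List (Fin n)) → count (λ v → does (v ∈? F)) ≤ length F
  count-∈ []      = ≤-reflexive (trans (∑-const n 0) (*-zeroʳ n))
  count-∈ (w ∷ F) = begin
    count (λ v → does (v ∈? w ∷ F))                           ≤⟨ ∑-mono (λ v → ind-∨ (does (v ≟ w)) (does (v ∈? F))) ⟩
    sum (λ v → ind (does (v ≟ w)) + ind (does (v ∈? F)))      ≡⟨ ∑-distrib-+ (λ v → ind (does (v ≟ w))) (λ v → ind (does (v ∈? F))) ⟩
    count (λ v → does (v ≟ w)) + count (λ v → does (v ∈? F))  ≤⟨ +-mono-≤ (count-single w) (count-∈ F) ⟩
    suc (length F)                                            ∎
    where open ≤-Reasoning

  avoid : (P : Fin n → Bool) (F : List (Fin n)) → length F < count P → ∃ λ v → T (P v) × v ∉ F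
  avoid P F lt =
    let v , gap   = ∑-witness _ _ (≤-<-trans (count-∈ F) lt)
        notIn , inP = ind-< gap
    in v , inP , λ v∈F → notIn (does-complete (v ∈? F) v∈F)

module _ {I : Set} {n : ℕ} where

  Representatives : List I → (I → Fin n → Bool) → List (Fin n) → Set
  Representatives xs C F =
    Σ (I → Fin n) λ f → (∀ x → x ∈ xs → T (C x (f x)) × f x ∉ F)
                      × (∀ {x y} → x ∈ xs → y ∈ xs → f x ≡ f y → x ≡ y)

  -- Greedy choice of distinct representatives: it suffices that every candidate set
  -- C x has at least |xs| + |F| elements, since each earlier choice and each
  -- forbidden element excludes only one candidate.
  greedy : DecidableEquality I → Fin n → (xs : List I) (C : I → Fin n → Bool) (F : List (Fin n)) →
           (∀ x → x ∈ xs → length xs + length F ≤ count (C x)) → Representatives xs C F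
  greedy _≟ᴵ_ default []       C F _    = (λ _ → default) , (λ _ ()) , λ ()
  greedy _≟ᴵ_ default (x ∷ xs) C F room = f , chosen , injective
    where
    fresh : ∃ λ v → T (C x v) × v ∉ F
    fresh = avoid (C x) F (≤-trans (s≤s (m≤n+m (length F) (length xs))) (room x (here refl)))

    v : Fin n
    v = proj₁ fresh

    rest : Representatives xs C (v ∷ F)
    rest = greedy _≟ᴵ_ default xs C (v ∷ F) (λ y y∈ → subst (_≤ count (C y)) (sym (+-suc _ _)) (room y (there y∈)))

    f′ : I → Fin n
    f′ = proj₁ rest

    f : I → Fin n
    f y with y ≟ᴵ x
    ... | yes _ = v
    ... | no  _ = f′ y

    others : ∀ {y} → y ∈ x ∷ xs → y ≢ x → y ∈ xs
    others (here y≡x) y≢x = ⊥-elim (y≢x y≡x)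
    others (there y∈) _   = y∈

    misses-v : ∀ {y} → y ∈ xs → f′ y ≢ v
    misses-v y∈ f′y≡v = proj₂ (proj₁ (proj₂ rest) _ y∈) (here f′y≡v)

    chosen : ∀ y → y ∈ x ∷ xs → T (C y (f y)) × f y ∉ F
    chosen y y∈ with y ≟ᴵ x
    ... | yes refl = proj₂ fresh
    ... | no  y≢x  = let inC , out = proj₁ (proj₂ rest) y (others y∈ y≢x) in inC , λ m → out (there m)

    injective : ∀ {y z} → y ∈ x ∷ xs → z ∈ x ∷ xs → f y ≡ f z → y ≡ z
    injective {y} {z} y∈ z∈ e with y ≟ᴵ x | z ≟ᴵ x
    ... | yes y≡x | yes z≡x = trans y≡x (sym z≡x)
    ... | yes _   | no  z≢x = ⊥-elim (misses-v (others z∈ z≢x) (sym e))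
    ... | no  y≢x | yes _   = ⊥-elim (misses-v (others y∈ y≢x) e)
    ... | no  y≢x | no  z≢x = proj₂ (proj₂ rest) (others y∈ y≢x) (others z∈ z≢x) e

  Choice : (I → Fin n → Bool) → List (Fin n) → Set
  Choice C F = Σ (I → Fin n) λ f → (∀ x → T (C x (f x)) × f x ∉ F) × Injective _≡_ _≡_ f

  greedy-all : DecidableEquality I → Fin n → (xs : List I) → (∀ x → x ∈ xs) →
               ∀ C F → (∀ x → length xs + length F ≤ count (C x)) → Choice C F
  greedy-all _≟ᴵ_ default xs enumerates C F room =
    let f , chosen , injective = greedy _≟ᴵ_ default xs C F (λ x _ → room x)
    in f , (λ x → chosen x (enumerates x)) , injective (enumerates _) (enumerates _)

module Neighbourhoods {N : ℕ} (adj : Fin N → Fin N → Bool) where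

  deg : Fin N → ℕ
  deg u = count (adj u)

  _∩Γ_ : (Fin N → Bool) → Fin N → Fin N → Bool
  (U ∩Γ v) u = U u ∧ adj u v

  adjFromAll : ∀ {r} → Vec (Fin N) r → Fin N → Bool
  adjFromAll []      v = true
  adjFromAll (x ∷ s) v = adj x v ∧ adjFromAll s v

  commonNbrs : ∀ {r} → Vec (Fin N) r → ℕ
  commonNbrs s = count (adjFromAll s)

  within-∩Γ : ∀ {r} U v (s : Vec (Fin N) r) → within (U ∩Γ v) s ≡ within U s ∧ adjFromAll s v
  within-∩Γ U v []      = refl
  within-∩Γ U v (x ∷ s) =
    trans (cong ((U x ∧ adj x v) ∧_) (within-∩Γ U v s)) (∧-interchange (U x) (adj x v) _ _)

  -- Double counting the edges leaving U, each u ∈ U having at least H neighbours.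
  edges-from : ∀ H U → (∀ u → T (U u) → H ≤ deg u) → count U * H ≤ sum (λ v → count (U ∩Γ v))
  edges-from H U high = begin
    count U * H                                         ≡⟨ *-distribʳ-sum H (λ u → ind (U u)) ⟩
    sum (λ u → ind (U u) * H)                           ≤⟨ ∑-mono weight ⟩
    sum (λ u → ind (U u) * deg u)                       ≡⟨ sum-cong-≗ (λ u → *-distribˡ-sum (ind (U u)) (λ v → ind (adj u v))) ⟩
    sum (λ u → sum (λ v → ind (U u) * ind (adj u v)))   ≡⟨ ∑-comm (λ u v → ind (U u) * ind (adj u v)) ⟩
    sum (λ v → sum (λ u → ind (U u) * ind (adj u v)))   ≡⟨ sum-cong-≗ (λ v → sum-cong-≗ (λ u → sym (ind-∧ (U u) (adj u v)))) ⟩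
    sum (λ v → count (U ∩Γ v))                          ∎
    where
    open ≤-Reasoning
    weight : ∀ u → ind (U u) * H ≤ ind (U u) * deg u
    weight u with U u in eq
    ... | true  = *-monoʳ-≤ 1 (high u (subst T (sym eq) _))
    ... | false = z≤n

  isBad : ∀ {r} → ℕ → Vec (Fin N) r → Bool
  isBad m s = does (commonNbrs s <? m)

  badIn : ∀ r → ℕ → (Fin N → Bool) → ℕ
  badIn r m U = ∑ᵗ r (λ s → ind (isBad m s ∧ within U s))

  -- A bad tuple stays inside U ∩Γ v for fewer than m choices of v.
  bad-survival : ∀ r m U → sum (λ v → badIn r m (U ∩Γ v)) ≤ badIn r m U * m
  bad-survival r m U = begin
    sum (λ v → badIn r m (U ∩Γ v))
      ≡⟨ sum-cong-≗ (λ v → ∑ᵗ-cong r (split v)) ⟩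
    sum (λ v → ∑ᵗ r (λ s → badWithin s * ind (adjFromAll s v)))
      ≡⟨ ∑-∑ᵗ-comm r (λ v s → badWithin s * ind (adjFromAll s v)) ⟩
    ∑ᵗ r (λ s → sum (λ v → badWithin s * ind (adjFromAll s v)))
      ≡⟨ ∑ᵗ-cong r (λ s → sym (*-distribˡ-sum (badWithin s) (λ v → ind (adjFromAll s v)))) ⟩
    ∑ᵗ r (λ s → badWithin s * commonNbrs s)
      ≤⟨ ∑ᵗ-mono r few ⟩
    ∑ᵗ r (λ s → badWithin s * m)
      ≡⟨ ∑ᵗ-*ʳ r badWithin m ⟩
    badIn r m U * m ∎
    where
    open ≤-Reasoning
    badWithin : Vec (Fin N) r → ℕ
    badWithin s = ind (isBad m s ∧ within U s)
    split : ∀ v s → ind (isBad m s ∧ within (U ∩Γ v) s) ≡ badWithin s * ind (adjFromAll s v)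
    split v s = begin-equality
      ind (isBad m s ∧ within (U ∩Γ v) s)         ≡⟨ cong (λ b → ind (isBad m s ∧ b)) (within-∩Γ U v s) ⟩
      ind (isBad m s ∧ (within U s ∧ adjFromAll s v)) ≡⟨ cong ind (sym (∧-assoc (isBad m s) _ _)) ⟩
      ind ((isBad m s ∧ within U s) ∧ adjFromAll s v) ≡⟨ ind-∧ (isBad m s ∧ within U s) (adjFromAll s v) ⟩
      badWithin s * ind (adjFromAll s v)          ∎
    few : ∀ s → badWithin s * commonNbrs s ≤ badWithin s * m
    few s with isBad m s in bad
    ... | true  = *-monoʳ-≤ (ind (within U s)) (<⇒≤ (does-sound (commonNbrs s <? m) (subst T (sym bad) _)))
    ... | false = z≤n

  module Rounds (r m k H : ℕ) where

    Potential : ℕ → (Fin N → Bool) → Set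
    Potential i U = (∀ u → T (U u) → H ≤ deg u) × (badIn r m U * m ^ i + k * N ^ i ≤ count U * H ^ i)

    regroup : ∀ a b c d e f → a * b * c + d * (f * e) ≡ a * (b * c) + f * (d * e)
    regroup = solve-∀

    -- One round: by averaging over v, some U ∩Γ v keeps the potential with one round fewer.
    round : 0 < N → ∀ i U → Potential (suc i) U → ∃ λ v → Potential i (U ∩Γ v)
    round N>0 i U (high , pot) =
      let v , le = averaging (λ v → count (U ∩Γ v) * H ^ i)
                             (λ v → badIn r m (U ∩Γ v) * m ^ i + k * N ^ i) N>0 totals
      in v , (λ u u∈ → high u (proj₁ (Equivalence.to T-∧ u∈))) , le
      where
      open ≤-Reasoning
      totals : sum (λ v → badIn r m (U ∩Γ v) * m ^ i + k * N ^ i) ≤ sum (λ v → count (U ∩Γ v) * H ^ i)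
      totals = begin
        sum (λ v → badIn r m (U ∩Γ v) * m ^ i + k * N ^ i)
          ≡⟨ ∑-distrib-+ (λ v → badIn r m (U ∩Γ v) * m ^ i) (λ _ → k * N ^ i) ⟩
        sum (λ v → badIn r m (U ∩Γ v) * m ^ i) + ∑[ v < N ] (k * N ^ i)
          ≡⟨ cong₂ _+_ (sym (*-distribʳ-sum (m ^ i) (λ v → badIn r m (U ∩Γ v)))) (∑-const N (k * N ^ i)) ⟩
        sum (λ v → badIn r m (U ∩Γ v)) * m ^ i + N * (k * N ^ i)
          ≤⟨ +-monoˡ-≤ _ (*-monoˡ-≤ (m ^ i) (bad-survival r m U)) ⟩
        badIn r m U * m * m ^ i + N * (k * N ^ i)
          ≡⟨ regroup (badIn r m U) m (m ^ i) N (N ^ i) k ⟩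
        badIn r m U * m ^ suc i + k * N ^ suc i
          ≤⟨ pot ⟩
        count U * H ^ suc i
          ≡⟨ *-assoc (count U) H (H ^ i) ⟨
        count U * H * H ^ i
          ≤⟨ *-monoˡ-≤ (H ^ i) (edges-from H U high) ⟩
        sum (λ v → count (U ∩Γ v)) * H ^ i
          ≡⟨ *-distribʳ-sum (H ^ i) (λ v → count (U ∩Γ v)) ⟩
        sum (λ v → count (U ∩Γ v) * H ^ i) ∎

    rounds : 0 < N → ∀ i U → Potential i U → ∃ λ U′ → badIn r m U′ + k ≤ count U′
    rounds N>0 zero    U (_ , pot) =
      U , subst₂ _≤_ (cong₂ _+_ (*-identityʳ _) (*-identityʳ k)) (*-identityʳ _) pot
    rounds N>0 (suc i) U pot =
      let v , pot′ = round N>0 i U pot in rounds N>0 i (U ∩Γ v) pot′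

  -- Deleting the first entry of every bad tuple inside U leaves a set without bad
  -- tuples, losing at most bad(U) vertices.
  delete-bad : ∀ q m k U → badIn (suc q) m U + k ≤ count U →
               ∃ λ U′ → k ≤ count U′ × (∀ (s : Vec (Fin N) (suc q)) → T (within U′ s) → m ≤ commonNbrs s)
  delete-bad q m k U room = cleared , large , noBad
    where
    startingAt : Fin N → ℕ
    startingAt x = ∑ᵗ q (λ s → ind (isBad m (x ∷ s) ∧ within U (x ∷ s)))

    cleared : Fin N → Bool
    cleared x = U x ∧ does (startingAt x ≟ℕ 0)

    unchanged : ∀ x → startingAt x ≡ 0 → cleared x ≡ U x
    unchanged x none = trans (cong (U x ∧_) (dec-true (startingAt x ≟ℕ 0) none)) (∧-identityʳ (U x))

    kept : ∀ x → ind (U x) ≤ ind (cleared x) + startingAt x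
    kept x with startingAt x ≟ℕ 0
    ... | yes none = ≤-trans (≤-reflexive (cong ind (sym (unchanged x none)))) (m≤m+n _ _)
    ... | no  some = ≤-trans (ind≤1 (U x)) (≤-trans (n≢0⇒n>0 some) (m≤n+m _ _))

    large : k ≤ count cleared
    large = +-cancelˡ-≤ (badIn (suc q) m U) k (count cleared) (begin
      badIn (suc q) m U + k                          ≤⟨ room ⟩
      count U                                        ≤⟨ ∑-mono kept ⟩
      sum (λ x → ind (cleared x) + startingAt x)     ≡⟨ ∑-distrib-+ (λ x → ind (cleared x)) startingAt ⟩
      count cleared + badIn (suc q) m U              ≡⟨ +-comm (count cleared) _ ⟩
      badIn (suc q) m U + count cleared              ∎)
      where open ≤-Reasoning

    cleared⊆U : ∀ u → T (cleared u) → T (U u)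
    cleared⊆U u = proj₁ ∘ Equivalence.to (T-∧ {U u})

    noBad : ∀ (s : Vec (Fin N) (suc q)) → T (within cleared s) → m ≤ commonNbrs s
    noBad (x ∷ s) inside with commonNbrs (x ∷ s) <? m
    ... | no  ¬bad = ≮⇒≥ ¬bad
    ... | yes bad  = ⊥-elim (n>0⇒n≢0 counted none)
      where
      x-cleared : T (cleared x)
      x-cleared = proj₁ (Equivalence.to (T-∧ {cleared x}) inside)
      none : startingAt x ≡ 0
      none = does-sound (startingAt x ≟ℕ 0) (proj₂ (Equivalence.to (T-∧ {U x}) x-cleared))
      badInside : T (isBad m (x ∷ s) ∧ within U (x ∷ s))
      badInside = Equivalence.from T-∧
        (does-complete (commonNbrs (x ∷ s) <? m) bad , within-mono cleared⊆U (x ∷ s) inside)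
      counted : 1 ≤ startingAt x
      counted = ≤-trans (T⇒1≤ind badInside)
                        (term≤∑ᵗ q (λ s → ind (isBad m (x ∷ s) ∧ within U (x ∷ s))) s)

  badIn≤ : ∀ r m U → badIn r m U ≤ count U ^ r
  badIn≤ r m U = ≤-trans (∑ᵗ-mono r (λ s → ind-mono (proj₂ ∘ Equivalence.to (T-∧ {isBad m s}))))
                         (≤-reflexive (count-within r U))

  dependent-random-choice :
    0 < N → ∀ q m k H t U → (∀ u → T (U u) → H ≤ deg u) →
    count U ^ suc q * m ^ t + k * N ^ t ≤ count U * H ^ t →
    ∃ λ U′ → k ≤ count U′ × (∀ (s : Vec (Fin N) (suc q)) → T (within U′ s) → m ≤ commonNbrs s)
  dependent-random-choice N>0 q m k H t U high pot =
    let U₁ , room = Rounds.rounds (suc q) m k H N>0 t U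
                      (high , ≤-trans (+-monoˡ-≤ _ (*-monoˡ-≤ (m ^ t) (badIn≤ (suc q) m U))) pot)
    in delete-bad q m k U₁ room

allVecs : ∀ p → List (Vec Bool p)
allVecs zero    = [] ∷ []
allVecs (suc p) = map (true ∷_) (allVecs p) ++ map (false ∷_) (allVecs p)

length-allVecs : ∀ p → length (allVecs p) ≡ 2 ^ p
length-allVecs zero    = refl
length-allVecs (suc p) = begin
  length (map (true ∷_) (allVecs p) ++ map (false ∷_) (allVecs p))
    ≡⟨ length-++ (map (true ∷_) (allVecs p)) ⟩
  length (map (true ∷_) (allVecs p)) + length (map (false ∷_) (allVecs p))
    ≡⟨ cong₂ _+_ (length-map (true ∷_) (allVecs p)) (length-map (false ∷_) (allVecs p)) ⟩
  length (allVecs p) + length (allVecs p)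
    ≡⟨ cong₂ _+_ (length-allVecs p) (trans (length-allVecs p) (sym (+-identityʳ (2 ^ p)))) ⟩
  2 ^ suc p ∎
  where open ≡-Reasoning

allVecs-complete : ∀ {p} (y : Vec Bool p) → y ∈ allVecs p
allVecs-complete []                = here refl
allVecs-complete {suc p} (true ∷ y)  = ∈-++⁺ˡ (∈-map⁺ (true ∷_) (allVecs-complete y))
allVecs-complete {suc p} (false ∷ y) = ∈-++⁺ʳ (map (true ∷_) (allVecs p)) (∈-map⁺ (false ∷_) (allVecs-complete y))

-- Parity of a 0/1-vector: the cube is bipartite into even and odd vectors.
parity : ∀ {n} → Vec Bool n → Bool
parity []      = false
parity (b ∷ y) = b xor parity y

flip : ∀ {n} → Fin n → Vec Bool n → Vec Bool n
flip zero    (b ∷ y) = not b ∷ y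
flip (suc j) (b ∷ y) = b ∷ flip j y

parity-flip : ∀ {n} (j : Fin n) x → parity (flip j x) ≡ not (parity x)
parity-flip zero    (b ∷ y) = sym (not-distribˡ-xor b (parity y))
parity-flip (suc j) (b ∷ y) = trans (cong (b xor_) (parity-flip j y)) (sym (not-distribʳ-xor b (parity y)))

flip-involutive : ∀ {n} (j : Fin n) x → flip j (flip j x) ≡ x
flip-involutive zero    (b ∷ y) = cong (_∷ y) (not-involutive b)
flip-involutive (suc j) (b ∷ y) = cong (b ∷_) (flip-involutive j y)

hamming-0 : ∀ {n} (u v : Vec Bool n) → hamming u v ≡ 0 → u ≡ v
hamming-0 []      []      _ = refl
hamming-0 (a ∷ u) (b ∷ v) h with a Bool.≟ b
... | yes refl = cong (a ∷_) (hamming-0 u v h)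

adjacent⇒flip : ∀ {n} (u v : Vec Bool n) → CubeAdj u v → ∃ λ j → v ≡ flip j u
adjacent⇒flip []      []      ()
adjacent⇒flip (a ∷ u) (b ∷ v) h with a Bool.≟ b
... | yes refl = let j , v≡ = adjacent⇒flip u v h in suc j , cong (a ∷_) v≡
... | no  a≢b  = zero , cong₂ _∷_ (¬-not (a≢b ∘ sym)) (sym (hamming-0 u v (suc-injective h)))

parity-tail-injective : ∀ {p} {x x′ : Vec Bool (suc p)} → parity x ≡ parity x′ → tail x ≡ tail x′ → x ≡ x′
parity-tail-injective {x = a ∷ y} {b ∷ .y} same refl = cong (_∷ y) (xor-cancelʳ a b (parity y) same)
  where
  xor-cancelʳ : ∀ a b c → a xor c ≡ b xor c → a ≡ b
  xor-cancelʳ false false c _ = refl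
  xor-cancelʳ true  true  c _ = refl
  xor-cancelʳ false true  c e = ⊥-elim (not-¬ refl e)
  xor-cancelʳ true  false c e = ⊥-elim (not-¬ refl (sym e))

odd : ∀ {p} → Vec Bool p → Vec Bool (suc p)
odd y = not (parity y) ∷ y

odd-tail : ∀ {p} (x : Vec Bool (suc p)) → parity x ≡ true → odd (tail x) ≡ x
odd-tail (b ∷ y) odd-x = parity-tail-injective (trans (xor-inverseˡ (parity y)) (sym odd-x)) refl

module CubeEmbedding {N : ℕ} (adj : Fin N → Fin N → Bool) where
  open Neighbourhoods adj

  adjFromAll-lookup : ∀ {r} (s : Vec (Fin N) r) v → T (adjFromAll s v) → ∀ j → T (adj (lookup s j) v)
  adjFromAll-lookup (x ∷ s) v common zero    = proj₁ (Equivalence.to (T-∧ {adj x v}) common)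
  adjFromAll-lookup (x ∷ s) v common (suc j) =
    adjFromAll-lookup s v (proj₂ (Equivalence.to (T-∧ {adj x v}) common)) j

  within-tabulate : ∀ {r} U (e : Fin r → Fin N) → (∀ j → T (U (e j))) → T (within U (tabulate e))
  within-tabulate {zero}  U e _   = _
  within-tabulate {suc r} U e e∈U =
    Equivalence.from T-∧ (e∈U zero , within-tabulate U (λ j → e (suc j)) (λ j → e∈U (suc j)))

  -- The map on Q_{p+1} given by g on even and by h on odd vertices, both read off
  -- the tail (which determines a vertex of known parity).
  glue : ∀ {p} → (Vec Bool p → Fin N) → (Vec Bool p → Fin N) → Vec Bool (suc p) → Fin N
  glue g h x = if parity x then h (tail x) else g (tail x)

  glue-injective : ∀ {p} {g h : Vec Bool p → Fin N} → Injective _≡_ _≡_ g → Injective _≡_ _≡_ h →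
                   (∀ y y′ → h y ≢ g y′) → Injective _≡_ _≡_ (glue g h)
  glue-injective g-inj h-inj disjoint {x} {x′} e with parity x in px | parity x′ in px′
  ... | false | false = parity-tail-injective (trans px (sym px′)) (g-inj e)
  ... | true  | true  = parity-tail-injective (trans px (sym px′)) (h-inj e)
  ... | true  | false = ⊥-elim (disjoint _ _ e)
  ... | false | true  = ⊥-elim (disjoint _ _ (sym e))

  nbrImages : ∀ {p} → (Vec Bool p → Fin N) → Vec Bool (suc p) → Vec (Fin N) (suc p)
  nbrImages g x = tabulate (λ j → g (tail (flip j x)))

  glue-edges : ∀ {p} (g h : Vec Bool p → Fin N) → (∀ y → T (adjFromAll (nbrImages g (odd y)) (h y))) →
               ∀ x j → parity x ≡ false → T (adj (glue g h x) (glue g h (flip j x)))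
  glue-edges {p} g h common x j even =
    subst₂ (λ a b → T (adj a b)) entry (sym (cong (λ b → if b then h (tail z) else g (tail z)) odd-z))
      (adjFromAll-lookup (nbrImages g z) (h (tail z)) common-z j)
    where
    z : Vec Bool (suc p)
    z = flip j x
    odd-z : parity z ≡ true
    odd-z = trans (parity-flip j x) (cong not even)
    common-z : T (adjFromAll (nbrImages g z) (h (tail z)))
    common-z = subst (λ w → T (adjFromAll (nbrImages g w) (h (tail z)))) (odd-tail z odd-z) (common (tail z))
    entry : lookup (nbrImages g z) j ≡ glue g h x
    entry = begin
      lookup (nbrImages g z) j     ≡⟨ lookup∘tabulate (λ i → g (tail (flip i z))) j ⟩
      g (tail (flip j z))          ≡⟨ cong (g ∘ tail) (flip-involutive j x) ⟩
      g (tail x)                   ≡⟨ cong (λ b → if b then h (tail x) else g (tail x)) even ⟨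
      glue g h x                   ∎
      where open ≡-Reasoning

  -- Embedding Q_{p+1}: the 2^p even vertices go injectively into U; each of the 2^p
  -- odd vertices then goes to a common neighbour of the images of its p+1 (even)
  -- neighbours, avoiding the 2^p even images and the other odd images -- possible
  -- since such tuples have at least 2^p + 2^p common neighbours.
  embed-cube : ∀ p → Fin N → ∀ U → 2 ^ p ≤ count U →
    (∀ (s : Vec (Fin N) (suc p)) → T (within U s) → 2 ^ suc p ≤ commonNbrs s) →
    Σ (Vec Bool (suc p) → Fin N) λ f →
      Injective _≡_ _≡_ f × (∀ x j → parity x ≡ false → T (adj (f x) (f (flip j x))))
  embed-cube p default U big rich =
    glue g h , glue-injective g-injective h-injective h-new , glue-edges g h h-common
    where
    evens : Choice (λ _ → U) []
    evens = greedy-all (≡-dec Bool._≟_) default (allVecs p) allVecs-complete (λ _ → U) []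
      (λ _ → subst (_≤ count U) (sym (trans (+-identityʳ _) (length-allVecs p))) big)

    g : Vec Bool p → Fin N
    g = proj₁ evens
    g∈U : ∀ y → T (U (g y))
    g∈U y = proj₁ (proj₁ (proj₂ evens) y)
    g-injective : Injective _≡_ _≡_ g
    g-injective = proj₂ (proj₂ evens)

    room : ∀ y → length (allVecs p) + length (map g (allVecs p)) ≤ commonNbrs (nbrImages g (odd y))
    room y = subst (_≤ commonNbrs (nbrImages g (odd y))) sizes
                   (rich (nbrImages g (odd y)) (within-tabulate U _ (λ j → g∈U (tail (flip j (odd y))))))
      where
      sizes : 2 ^ suc p ≡ length (allVecs p) + length (map g (allVecs p))
      sizes = sym (cong₂ _+_ (length-allVecs p)
                             (trans (length-map g (allVecs p)) (trans (length-allVecs p) (sym (+-identityʳ _)))))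

    odds : Choice (λ y → adjFromAll (nbrImages g (odd y))) (map g (allVecs p))
    odds = greedy-all (≡-dec Bool._≟_) default (allVecs p) allVecs-complete
                      (λ y → adjFromAll (nbrImages g (odd y))) (map g (allVecs p)) room

    h : Vec Bool p → Fin N
    h = proj₁ odds
    h-common : ∀ y → T (adjFromAll (nbrImages g (odd y)) (h y))
    h-common y = proj₁ (proj₁ (proj₂ odds) y)
    h-new : ∀ y y′ → h y ≢ g y′
    h-new y y′ hy≡gy′ = proj₂ (proj₁ (proj₂ odds) y) (subst (_∈ map g (allVecs p)) (sym hy≡gy′) (∈-map⁺ g (allVecs-complete y′)))
    h-injective : Injective _≡_ _≡_ h
    h-injective = proj₂ (proj₂ odds)

half : ∀ H a b → H + H ≤ suc (a + b) → H ≤ a ⊎ H ≤ b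
half H a b total with H ≤? a
... | yes H≤a = inj₁ H≤a
... | no  H≰a = inj₂ (+-cancelˡ-≤ H H b (≤-trans total (+-monoˡ-≤ b (≰⇒> H≰a))))

module Colouring {N : ℕ} (c : TwoColouring N) where

  edgeOf : Fin 2 → Fin N → Fin N → Bool
  edgeOf κ u v = not (does (v ≟ u)) ∧ does (colour c u v ≟ κ)

  edgeOf-colour : ∀ κ u v → T (edgeOf κ u v) → colour c u v ≡ κ
  edgeOf-colour κ u v e = does-sound (colour c u v ≟ κ) (proj₂ (Equivalence.to (T-∧ {not (does (v ≟ u))}) e))

  deg : Fin 2 → Fin N → ℕ
  deg κ = Neighbourhoods.deg (edgeOf κ)

  -- Every vertex other than u is joined to u in one of the two colours.
  degree-sum : ∀ u → N ≤ suc (deg zero u + deg (suc zero) u)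
  degree-sum u = begin
    N                                               ≡⟨ ∑-ones N ⟨
    ∑[ v < N ] 1                                    ≤⟨ ∑-mono joined ⟩
    sum (λ v → ind (edgeOf zero u v) + ind (edgeOf (suc zero) u v) + ind (does (v ≟ u)))
                                                    ≡⟨ ∑-distrib-+ _ (λ v → ind (does (v ≟ u))) ⟩
    sum (λ v → ind (edgeOf zero u v) + ind (edgeOf (suc zero) u v)) + count (λ v → does (v ≟ u))
                                                    ≤⟨ +-mono-≤ (≤-reflexive (∑-distrib-+ (λ v → ind (edgeOf zero u v)) (λ v → ind (edgeOf (suc zero) u v)))) (count-single u) ⟩
    deg zero u + deg (suc zero) u + 1               ≡⟨ +-comm _ 1 ⟩
    suc (deg zero u + deg (suc zero) u)             ∎
    where
    open ≤-Reasoning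
    joined : ∀ v → 1 ≤ ind (not (does (v ≟ u)) ∧ does (colour c u v ≟ zero))
                     + ind (not (does (v ≟ u)) ∧ does (colour c u v ≟ suc zero))
                     + ind (does (v ≟ u))
    joined v with v ≟ u
    ... | yes _ = ≤-refl
    ... | no  _ with colour c u v
    ... | zero     = ≤-refl
    ... | suc zero = ≤-refl

  majority : ∀ H → H + H ≤ N →
    ∃ λ κ → Σ (Fin N → Bool) λ W → (∀ u → T (W u) → H ≤ deg κ u) × H ≤ count W
  majority H 2H≤N = choose (half H (count (high zero)) (count (high (suc zero))) covered)
    where
    high : Fin 2 → Fin N → Bool
    high κ u = does (H ≤? deg κ u)

    either : ∀ u → 1 ≤ ind (high zero u) + ind (high (suc zero) u)
    either u with half H (deg zero u) (deg (suc zero) u) (≤-trans 2H≤N (degree-sum u))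
    ... | inj₁ H≤d₀ = ≤-trans (T⇒1≤ind (does-complete (H ≤? deg zero u) H≤d₀)) (m≤m+n _ _)
    ... | inj₂ H≤d₁ = ≤-trans (T⇒1≤ind (does-complete (H ≤? deg (suc zero) u) H≤d₁)) (m≤n+m _ _)

    covered : H + H ≤ suc (count (high zero) + count (high (suc zero)))
    covered = begin
      H + H                                               ≤⟨ 2H≤N ⟩
      N                                                   ≡⟨ ∑-ones N ⟨
      ∑[ u < N ] 1                                        ≤⟨ ∑-mono either ⟩
      sum (λ u → ind (high zero u) + ind (high (suc zero) u))
                                                          ≡⟨ ∑-distrib-+ (λ u → ind (high zero u)) (λ u → ind (high (suc zero) u)) ⟩
      count (high zero) + count (high (suc zero))         ≤⟨ n≤1+n _ ⟩
      suc (count (high zero) + count (high (suc zero)))   ∎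
      where open ≤-Reasoning

    choose : H ≤ count (high zero) ⊎ H ≤ count (high (suc zero)) →
             ∃ λ κ → Σ (Fin N → Bool) λ W → (∀ u → T (W u) → H ≤ deg κ u) × H ≤ count W
    choose (inj₁ large) = zero     , high zero     , (λ u → does-sound (H ≤? deg zero u))     , large
    choose (inj₂ large) = suc zero , high (suc zero) , (λ u → does-sound (H ≤? deg (suc zero) u)) , large

  monochromatic : ∀ {r} κ (f : Vec Bool r → Fin N) → Injective _≡_ _≡_ f →
    (∀ x j → parity x ≡ false → T (edgeOf κ (f x) (f (flip j x)))) → MonoCube c r
  monochromatic κ f injective edges = κ , f , injective , coloured
    where
    coloured : ∀ u v → CubeAdj u v → colour c (f u) (f v) ≡ κ
    coloured u v adjacent with adjacent⇒flip u v adjacent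
    ... | j , refl with parity u in even
    ... | false = edgeOf-colour κ _ _ (edges u j even)
    ... | true  = trans (symmetric c _ _) (edgeOf-colour κ _ _ (subst (λ w → T (edgeOf κ (f (flip j u)) (f w)))
                    (flip-involutive j u) (edges (flip j u) j (trans (parity-flip j u) (cong not even)))))

module Parameters (p : ℕ) where

  N H m k t : ℕ
  N = 2 ^ (3 * suc p)
  H = 2 ^ (3 * p + 2)
  m = 2 ^ suc p
  k = 2 ^ p
  t = 2 * p + 1

  N≡H+H : N ≡ H + H
  N≡H+H = trans (cong (2 ^_) (exponent p)) (cong (H +_) (+-identityʳ H))
    where
    exponent : ∀ q → 3 * suc q ≡ suc (3 * q + 2)
    exponent = solve-∀

  first-term : 2 * (N ^ p * m ^ t) ≤ H ^ t
  first-term = begin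
    2 * (N ^ p * m ^ t)                      ≡⟨ cong (2 *_) (trans (cong₂ _*_ (^-*-assoc 2 (3 * suc p) p) (^-*-assoc 2 (suc p) t))
                                                                   (sym (^-distribˡ-+-* 2 (3 * suc p * p) (suc p * t)))) ⟩
    2 ^ suc (3 * suc p * p + suc p * t)      ≤⟨ ^-monoʳ-≤ 2 (≤-trans (m≤m+n (suc (3 * suc p * p + suc p * t)) (p * p + p)) (≤-reflexive (exponents p))) ⟩
    2 ^ ((3 * p + 2) * t)                    ≡⟨ ^-*-assoc 2 (3 * p + 2) t ⟨
    H ^ t                                    ∎
    where
    open ≤-Reasoning
    exponents : ∀ q → suc (3 * suc q * q + suc q * (2 * q + 1)) + (q * q + q) ≡ (3 * q + 2) * (2 * q + 1)
    exponents = solve-∀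

  second-term : 2 * (k * N ^ t) ≡ H * H ^ t
  second-term = begin
    2 * (k * N ^ t)                          ≡⟨ cong (2 *_) (trans (cong (k *_) (^-*-assoc 2 (3 * suc p) t))
                                                                   (sym (^-distribˡ-+-* 2 p (3 * suc p * t)))) ⟩
    2 ^ suc (p + 3 * suc p * t)              ≡⟨ cong (2 ^_) (exponents p) ⟩
    2 ^ (3 * p + 2 + (3 * p + 2) * t)        ≡⟨ trans (cong (H *_) (^-*-assoc 2 (3 * p + 2) t))
                                                      (sym (^-distribˡ-+-* 2 (3 * p + 2) ((3 * p + 2) * t))) ⟨
    H * H ^ t                                ∎
    where
    open ≡-Reasoning
    exponents : ∀ q → suc (q + 3 * suc q * (2 * q + 1)) ≡ 3 * q + 2 + (3 * q + 2) * (2 * q + 1)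
    exponents = solve-∀

  potential : ∀ a → H ≤ a → a ≤ N → a ^ suc p * m ^ t + k * N ^ t ≤ a * H ^ t
  potential a H≤a a≤N = *-cancelˡ-≤ 2 (begin
    2 * (a ^ suc p * m ^ t + k * N ^ t)          ≤⟨ *-monoʳ-≤ 2 (+-monoˡ-≤ _ (*-monoˡ-≤ (m ^ t) (*-monoʳ-≤ a (^-monoˡ-≤ p a≤N)))) ⟩
    2 * (a * N ^ p * m ^ t + k * N ^ t)          ≡⟨ regroup a (N ^ p) (m ^ t) (k * N ^ t) ⟩
    a * (2 * (N ^ p * m ^ t)) + 2 * (k * N ^ t)  ≤⟨ +-mono-≤ (*-monoʳ-≤ a first-term) (≤-trans (≤-reflexive second-term) (*-monoˡ-≤ (H ^ t) H≤a)) ⟩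
    a * H ^ t + a * H ^ t                        ≡⟨ cong (a * H ^ t +_) (+-identityʳ _) ⟨
    2 * (a * H ^ t)                              ∎)
    where
    open ≤-Reasoning
    regroup : ∀ a x y z → 2 * (a * x * y + z) ≡ a * (2 * (x * y)) + 2 * z
    regroup = solve-∀

theorem3p4 : (r : ℕ) → 1 ≤ r → CubeRamseyAtMost r (2 ^ (3 * r))
theorem3p4 zero    ()
theorem3p4 (suc p) _ c =
  let κ , W , high , W-large = majority H (≤-reflexive (sym N≡H+H))
      G                      = edgeOf κ
      U , U-large , rich     = Neighbourhoods.dependent-random-choice G N>0 p m k H t W high
                                 (potential (count W) W-large (count≤ W))
      f , injective , edges  = CubeEmbedding.embed-cube G p (fromℕ< N>0) U U-large rich
  in monochromatic κ f injective edges
  where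
  open Parameters p
  open Colouring c
  N>0 : 0 < N
  N>0 = m^n>0 2 (3 * suc p)
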